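{- Let $t<k$ be positive integers and let $2\le v_1\le v_2\le\cdots\le v_{k-t}$ and $2v_{k-t}\le v_{k-t+1}\le\cdots\le v_k$ be integers. Then $(\bar{1},t)\text{ -LAN}(k,(v_1,\dots,v_k))\ge \prod_{i=k-t+1}^{k} v_i$.
   Context: Let $k,t,N$ be positive integers with $t<k$. For positive integers $v_1,\dots,v_k$, consider $N\times k$ arrays $A=(a_{rj})$ whose $j$-th column has entries from a fixed set $V_j$ with $|V_j|=v_j$. A $t$-way interaction is a set $T=\{(j,\sigma_j): j\in I\}$ with $I\subseteq\{1,\dots,k\}$, $|I|=t$, $\sigma_j\in V_j$. Let $\rho(A,T)$ be the set of row indices $r$ with $a_{rj}=\sigma_j$ for all $j\in I$, and for a set $\mathcal T$ of $t$-way interactions $\rho(A,\mathcal T)=\bigcup_{T\in\mathcal T}\rho(A,T)$. $A$ is a $(\bar 1,t)$-LA$(N;k,(v_1,\dots,v_k))$ if for all sets $\mathcal T_1,\mathcal T_2$ of $t$-way interactions with $|\mathcal T_1|\le1$, $|\mathcal T_2|\le1$: $\rho(A,\mathcal T_1)=\rho(A,\mathcal T_2)\iff \mathcal T_1=\mathcal T_2$ (equivalently: every $t$-way interaction occurs in some row, and distinct $t$-way interactions have distinct $\rho$). $(\bar1,t)$-LAN$(k,(v_1,\dots,v_k))$ is the minimum $N$ for which such an array exists. -}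

module Defs where

open import Data.Nat using (ℕ; zero; suc; _+_; _*_)
open import Data.Fin using (Fin; zero; suc)
open import Data.Maybe using (Maybe; just; nothing; is-just)
open import Data.Bool using (if_then_else_)
open import Data.Empty using (⊥)
open import Data.Unit using (⊤)
open import Data.Product using (_×_)
open import Relation.Binary.PropositionalEquality using (_≡_)
open import Function.Bundles using (_⇔_)

Array : (N k : ℕ) → (Fin k → ℕ) → Set
Array N k v = Fin N → (j : Fin k) → Fin (v j)

-- A partial assignment of values to columns: nothing = column not in I.
Assignment : (k : ℕ) → (Fin k → ℕ) → Set
Assignment k v = (j : Fin k) → Maybe (Fin (v j))

support : ∀ {k} {v : Fin k → ℕ} → Assignment k v → ℕ
support {zero}  T = 0
support {suc k} T = (if is-just (T zero) then 1 else 0) + support {k} (λ j → T (suc j))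

record Interaction (k t : ℕ) (v : Fin k → ℕ) : Set where
  constructor interaction
  field
    assign : Assignment k v
    size   : support assign ≡ t
open Interaction public

Covers : ∀ {N k t v} → Array N k v → Interaction k t v → Fin N → Set
Covers A T r = ∀ j σ → assign T j ≡ just σ → A r j ≡ σ

-- sets of t-way interactions of size at most 1: nothing = ∅, just T = {T}
SmallSet : (k t : ℕ) → (Fin k → ℕ) → Set
SmallSet k t v = Maybe (Interaction k t v)

ρ : ∀ {N k t v} → Array N k v → SmallSet k t v → Fin N → Set
ρ A nothing  r = ⊥
ρ A (just T) r = Covers A T r

SameRows : ∀ {N k t v} → Array N k v → SmallSet k t v → SmallSet k t v → Set
SameRows A 𝒯₁ 𝒯₂ = ∀ r → ρ A 𝒯₁ r ⇔ ρ A 𝒯₂ r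

-- equality of sets of interactions (interactions compared as sets of pairs,
-- i.e. pointwise on the assignment)
SameSet : ∀ {k t v} → SmallSet k t v → SmallSet k t v → Set
SameSet nothing  nothing  = ⊤
SameSet nothing  (just _) = ⊥
SameSet (just _) nothing  = ⊥
SameSet (just T) (just T′) = ∀ j → assign T j ≡ assign T′ j

IsLA1 : (N k t : ℕ) (v : Fin k → ℕ) → Array N k v → Set
IsLA1 N k t v A = ∀ (𝒯₁ 𝒯₂ : SmallSet k t v) → SameRows A 𝒯₁ 𝒯₂ ⇔ SameSet 𝒯₁ 𝒯₂

∏ : ∀ {n} → (Fin n → ℕ) → ℕ
∏ {zero}  f = 1
∏ {suc n} f = f zero * ∏ (λ j → f (suc j))

-- Only the covering part of the locating property is needed: every t-way
-- interaction on the last t columns must occur in some row, and a row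
-- determines the interaction on those columns it covers.  Hence sending each
-- such interaction to a covering row is injective, and there are
-- ∏_{i > k-t} v_i of them.
module Submission where

open import Defs
open import Data.Nat using (ℕ; _≤_; _<_; _∸_; _*_)
open import Data.Fin using (Fin; toℕ)
open import Data.Bool using (if_then_else_)
open import Relation.Nullary.Decidable using (⌊_⌋)
open import Data.Nat using (_≤?_)
open import Relation.Binary.PropositionalEquality using (_≡_)

open import Data.Nat using (zero; suc; s≤s; s≤s⁻¹)
open import Data.Nat.Properties using (m∸[m∸n]≡n; <⇒≤)
open import Data.Fin using (zero; suc; remQuot; combine)
open import Data.Fin.Properties using (combine-remQuot; any?; all?; _≟_; injective⇒≤)
open import Data.Maybe using (Maybe; just; nothing; is-just)
open import Data.Product using (_,_; proj₁; proj₂; ∃)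
open import Data.Empty using (⊥-elim)
open import Relation.Nullary using (Dec; yes; no)
open import Relation.Nullary.Decidable using (isYes≗does; does-⇔)
open import Relation.Unary using (Pred; Decidable)
open import Relation.Binary.PropositionalEquality using (refl; sym; trans; cong; cong₂; subst)
open import Function.Base using (_∘_)
open import Function.Bundles using (mk⇔; Equivalence)

Tuple : ∀ {n} → (Fin n → ℕ) → Set
Tuple {n} w = (j : Fin n) → Fin (w j)

-- Mixed-radix digits of a number below ∏ w.
digits : ∀ {n} (w : Fin n → ℕ) → Fin (∏ w) → Tuple w
digits {suc n} w x zero    = proj₁ (remQuot {w zero} (∏ (λ j → w (suc j))) x)
digits {suc n} w x (suc j) =
  digits (λ j → w (suc j)) (proj₂ (remQuot {w zero} (∏ (λ j → w (suc j))) x)) j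

digits-injective : ∀ {n} (w : Fin n → ℕ) {x y : Fin (∏ w)} →
  (∀ j → digits w x j ≡ digits w y j) → x ≡ y
digits-injective {zero}  w {zero} {zero} _ = refl
digits-injective {suc n} w {x} {y} same = begin
  x                                          ≡⟨ sym (combine-remQuot {w zero} P x) ⟩
  combine (proj₁ (split x)) (proj₂ (split x)) ≡⟨ cong₂ combine (same zero) tails ⟩
  combine (proj₁ (split y)) (proj₂ (split y)) ≡⟨ combine-remQuot {w zero} P y ⟩
  y                                          ∎
  where
  open Relation.Binary.PropositionalEquality.≡-Reasoning
  P = ∏ (λ j → w (suc j))
  split = remQuot {w zero} P
  tails : proj₂ (split x) ≡ proj₂ (split y)
  tails = digits-injective (λ j → w (suc j)) (λ j → same (suc j))

Covers? : ∀ {N k t v} (A : Array N k v) (T : Interaction k t v) → Decidable (Covers A T)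
Covers? A T r = all? column?
  where
  column? : ∀ j → Dec (∀ σ → assign T j ≡ just σ → A r j ≡ σ)
  column? j with assign T j
  ... | nothing = yes (λ _ ())
  ... | just s with A r j ≟ s
  ...   | yes A≡s = yes (λ { _ refl → A≡s })
  ...   | no  A≢s = no (λ covered → A≢s (covered s refl))

IsLA1⇒covering : ∀ {N k t v} {A : Array N k v} → IsLA1 N k t v A →
  (T : Interaction k t v) → ∃ (Covers A T)
IsLA1⇒covering {A = A} isLA T with any? (Covers? A T)
... | yes covered = covered
... | no  uncovered = ⊥-elim (Equivalence.to (isLA (just T) nothing) noRow)
  where
  noRow : SameRows A (just T) nothing
  noRow r = mk⇔ (λ c → uncovered (r , c)) ⊥-elim

⌊s≤?s⌋ : ∀ m n → ⌊ suc m ≤? suc n ⌋ ≡ ⌊ m ≤? n ⌋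
⌊s≤?s⌋ m n = trans (isYes≗does (suc m ≤? suc n))
  (trans (does-⇔ (mk⇔ s≤s⁻¹ s≤s) (suc m ≤? suc n) (m ≤? n)) (sym (isYes≗does (m ≤? n))))

support-suffix : ∀ k {v : Fin k → ℕ} (T : Assignment k v) (m : ℕ) →
  (∀ j → is-just (T j) ≡ ⌊ m ≤? toℕ j ⌋) → support T ≡ k ∸ m
support-suffix zero    T zero    _ = refl
support-suffix zero    T (suc m) _ = refl
support-suffix (suc k) T zero    onSuffix rewrite onSuffix zero =
  cong suc (support-suffix k (λ j → T (suc j)) zero (λ j → onSuffix (suc j)))
support-suffix (suc k) T (suc m) onSuffix rewrite onSuffix zero =
  support-suffix k (λ j → T (suc j)) m (λ j → trans (onSuffix (suc j)) (⌊s≤?s⌋ m (toℕ j)))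

optional : ∀ {w : ℕ} {q} {Q : Set q} (Q? : Dec Q) → Fin (if ⌊ Q? ⌋ then w else 1) → Maybe (Fin w)
optional (yes _) x = just x
optional (no  _) _ = nothing

is-just-optional : ∀ {w : ℕ} {q} {Q : Set q} (Q? : Dec Q) (x : Fin (if ⌊ Q? ⌋ then w else 1)) →
  is-just (optional Q? x) ≡ ⌊ Q? ⌋
is-just-optional (yes _) _ = refl
is-just-optional (no  _) _ = refl

optional-determined : ∀ {w : ℕ} {q} {Q : Set q} (Q? : Dec Q) (a : Fin w) {x y} →
  (∀ σ → optional Q? x ≡ just σ → a ≡ σ) →
  (∀ σ → optional Q? y ≡ just σ → a ≡ σ) → x ≡ y
optional-determined (yes _) a {x} {y} ax ay = trans (sym (ax x refl)) (ay y refl)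
optional-determined (no  _) a {zero} {zero} _ _ = refl

-- An interaction supported on the columns satisfying P is a tuple of values
-- over those columns, padded with the single element of Fin 1 elsewhere.
module Restricted {k} {v : Fin k → ℕ} {p} {P : Pred (Fin k) p} (P? : Decidable P) where

  width : Fin k → ℕ
  width j = if ⌊ P? j ⌋ then v j else 1

  restrict : Tuple width → Assignment k v
  restrict f j = optional (P? j) (f j)

  is-just-restrict : ∀ f j → is-just (restrict f j) ≡ ⌊ P? j ⌋
  is-just-restrict f j = is-just-optional (P? j) (f j)

  covering⇒∏width≤ : ∀ {N t} (A : Array N k v) →
    (∀ f → support (restrict f) ≡ t) →
    (∀ (T : Interaction k t v) → ∃ (Covers A T)) → ∏ width ≤ N
  covering⇒∏width≤ A supported covering = injective⇒≤ {f = row ∘ digits width} row-injective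
    where
    row : Tuple width → _
    row f = proj₁ (covering (interaction (restrict f) (supported f)))

    row-covers : ∀ f → Covers A (interaction (restrict f) (supported f)) (row f)
    row-covers f = proj₂ (covering (interaction (restrict f) (supported f)))

    row-injective : ∀ {x y} → (row ∘ digits width) x ≡ (row ∘ digits width) y → x ≡ y
    row-injective {x} {y} sameRow = digits-injective width λ j →
      optional-determined (P? j) (A (row fy) j)
        (λ σ eq → subst (λ r → A r j ≡ σ) sameRow (row-covers fx j σ eq))
        (row-covers fy j)
      where
      fx = digits width x
      fy = digits width y

lemma3p1 : (k t : ℕ) → 1 ≤ t → t < k → (v : Fin k → ℕ) →
    (∀ i → toℕ i < k ∸ t → 2 ≤ v i) →
    (∀ i j → toℕ i ≤ toℕ j → toℕ j < k ∸ t → v i ≤ v j) →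
    (∀ i j → toℕ i ≡ k ∸ t ∸ 1 → toℕ j ≡ k ∸ t → 2 * v i ≤ v j) →
    (∀ i j → k ∸ t ≤ toℕ i → toℕ i ≤ toℕ j → v i ≤ v j) →
    (N : ℕ) → (A : Array N k v) → IsLA1 N k t v A →
    ∏ (λ j → if ⌊ k ∸ t ≤? toℕ j ⌋ then v j else 1) ≤ N
lemma3p1 k t _ t<k v _ _ _ _ N A isLA =
  covering⇒∏width≤ A suffix-support (IsLA1⇒covering isLA)
  where
  open Restricted (λ j → k ∸ t ≤? toℕ j)
  suffix-support : ∀ f → support (restrict f) ≡ t
  suffix-support f = trans (support-suffix k (restrict f) (k ∸ t) (is-just-restrict f))
                           (m∸[m∸n]≡n (<⇒≤ t<k))
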